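{- Let $\mathcal{H}_1$ and $\mathcal{H}_2$ be connected hypergraphs with disjoint vertex sets. Then $\gamma_{P_I}(\mathcal{H}_1\star\mathcal{H}_2)\le\gamma_P(\mathcal{H}_1\star\mathcal{H}_2)\le\gamma(\mathcal{H}_1\star\mathcal{H}_2)\le 2$. Furthermore, if $\gamma_{P_I}(\mathcal{H}_1)=1$ or $\gamma_{P_I}(\mathcal{H}_2)=1$, then $\gamma_{P_I}(\mathcal{H}_1\star\mathcal{H}_2)=1$.
   Context: A hypergraph $\mathcal{H}=(V,E)$ has finite vertex set $V$ and edges nonempty subsets of $V$; throughout, hypergraphs are reduced and have at least one edge. A path is a sequence $v_1,e_1,v_2,\dots,e_\ell,v_{\ell+1}$ of distinct vertices and distinct edges with $v_i,v_{i+1}\in e_i$; $\mathcal{H}$ is connected if any two vertices are joined by a path. The linear sum is $\mathcal{H}_1\star\mathcal{H}_2=(V(\mathcal{H}_1)\cup V(\mathcal{H}_2),\{e_1\cup e_2: e_1\in E(\mathcal{H}_1),e_2\in E(\mathcal{H}_2)\})$. $N[a]=\bigcup_{a\in e\in E}e$, $N(a)=N[a]\setminus\{a\}$. A dominating set is $D\subseteq V$ with $V=\bigcup_{d\in D}N[d]$; $\gamma(\mathcal{H})$ is its minimum size. Power domination: given $S_0\subseteq V$, first all vertices of $\bigcup_{v\in S_0}N[v]$ become observed; then repeatedly, if all unobserved neighbors of an observed vertex $v$ lie in one edge incident to $v$, they become observed. $\gamma_P(\mathcal{H})$ is the minimum size of an $S_0$ making all vertices observed. Infectious power domination: given $S_0$,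 set $S=\bigcup_{v\in S_0}N[v]$; then while some nonempty $A\subseteq S$ and edge $e$ satisfy $A\subseteq e$ and [every vertex $v\notin S$ such that $A\cup\{v\}$ is contained in some edge lies in $e$], add the vertices of $e$ to $S$. $\gamma_{P_I}(\mathcal{H})$ is the minimum size of an $S_0$ with $S=V$ at termination. -}

module Defs where

open import Data.Nat using (ℕ; zero; suc; _+_; _≤_)
open import Data.Fin using (Fin; inject₁)
open import Data.Fin.Subset public
  using (Subset; _∈_; _∉_; _⊆_; _∪_; ⊤; ∣_∣; Nonempty)
open import Data.Vec using (_++_)
open import Data.List using (List; []; _∷_; concatMap; map)
open import Data.List.Membership.Propositional using () renaming (_∈_ to _∈ₗ_)
open import Data.Product using (Σ; ∃; _×_; _,_)
open import Data.Sum using (_⊎_)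
open import Function using (Injective)
open import Relation.Binary.PropositionalEquality using (_≡_; _≢_)
open import Relation.Binary.Construct.Closure.ReflexiveTransitive using (Star)
open import Relation.Nullary using (¬_)
open import Function.Bundles using (_⇔_)

-- A hypergraph on the vertex set V = Fin n; edges are subsets of V,
-- listed (the edge set is the set of list entries).
record Hypergraph (n : ℕ) : Set where
  constructor hypergraph
  field
    edges : List (Subset n)
open Hypergraph public

Reduced : ∀ {n} → Hypergraph n → Set
Reduced H = ∀ e f → e ∈ₗ edges H → f ∈ₗ edges H → e ⊆ f → e ≡ f

WellFormed : ∀ {n} → Hypergraph n → Set
WellFormed H =
  (∀ e → e ∈ₗ edges H → Nonempty e) × (edges H ≢ []) × Reduced H

record Path {n} (H : Hypergraph n) (u v : Fin n) : Set where
  field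
    len    : ℕ
    verts  : Fin (suc len) → Fin n
    edgs   : Fin len → Subset n
    verts-inj : Injective _≡_ _≡_ verts
    edgs-inj  : Injective _≡_ _≡_ edgs
    edgs-in   : ∀ i → edgs i ∈ₗ edges H
    left-in   : ∀ i → verts (inject₁ i) ∈ edgs i
    right-in  : ∀ i → verts (Fin.suc i) ∈ edgs i
    start     : verts Fin.zero ≡ u
    end       : verts (Data.Fin.fromℕ len) ≡ v

Connected : ∀ {n} → Hypergraph n → Set
Connected {n} H = ∀ (u v : Fin n) → Path H u v

-- Linear sum of hypergraphs on disjoint vertex sets Fin n₁, Fin n₂,
-- realised on Fin (n₁ + n₂) (first n₁ vertices from H₁, rest from H₂).
_⋆_ : ∀ {n₁ n₂} → Hypergraph n₁ → Hypergraph n₂ → Hypergraph (n₁ + n₂)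
H₁ ⋆ H₂ = hypergraph
  (concatMap (λ e₁ → map (λ e₂ → e₁ ++ e₂) (edges H₂)) (edges H₁))

InN[_] : ∀ {n} → Hypergraph n → Fin n → Fin n → Set
InN[ H ] a w = ∃ λ e → e ∈ₗ edges H × a ∈ e × w ∈ e

Dominating : ∀ {n} → Hypergraph n → Subset n → Set
Dominating H D = ∀ w → ∃ λ d → d ∈ D × InN[ H ] d w

InitialSet : ∀ {n} → Hypergraph n → Subset n → Subset n → Set
InitialSet H S₀ S = ∀ w → (w ∈ S ⇔ (∃ λ d → d ∈ S₀ × InN[ H ] d w))

PDStep : ∀ {n} → Hypergraph n → Subset n → Subset n → Set
PDStep H O O' = ∃ λ v → ∃ λ e →
  v ∈ O × e ∈ₗ edges H × v ∈ e ×
  (∀ u → InN[ H ] v u → u ≢ v → u ∉ O → u ∈ e) ×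
  (∀ w → (w ∈ O' ⇔ (w ∈ O ⊎ (InN[ H ] v w × w ≢ v))))

PowerDominating : ∀ {n} → Hypergraph n → Subset n → Set
PowerDominating H S₀ =
  ∃ λ S → InitialSet H S₀ S × Star (PDStep H) S ⊤

IPDStep : ∀ {n} → Hypergraph n → Subset n → Subset n → Set
IPDStep H S S' = ∃ λ A → ∃ λ e →
  Nonempty A × A ⊆ S × e ∈ₗ edges H × A ⊆ e ×
  (∀ v → v ∉ S → (∃ λ f → f ∈ₗ edges H × A ⊆ f × v ∈ f) → v ∈ e) ×
  (S' ≡ S ∪ e)

InfPowerDominating : ∀ {n} → Hypergraph n → Subset n → Set
InfPowerDominating H S₀ =
  ∃ λ S → InitialSet H S₀ S × Star (IPDStep H) S ⊤

IsMin : ∀ {n} → (Subset n → Set) → ℕ → Set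
IsMin P k = (∃ λ S → P S × ∣ S ∣ ≡ k) × (∀ S → P S → k ≤ ∣ S ∣)

module Submission where

-- Write G = H₁ ⋆ H₂.  Every vertex of a connected (well-formed) hypergraph
-- lies in some edge, so in G every vertex of H₁ is adjacent to every vertex
-- of H₂; hence one vertex from each side dominates G, and γ(G) ≤ 2.
-- Every dominating set is power dominating and every power dominating set
-- is infectious power dominating, so the three minima are ordered.
-- Since the statement asks for the minima themselves, we must decide whether
-- a single vertex suffices; this needs decidability of (infectious) power
-- domination, which follows from a general fact: reaching the full vertex set
-- under an inflationary, monotone step relation whose "can grow" question
-- is decidable is itself decidable.  Finally, an infectious propagation in
-- H₁ started from ⁅ v ⁆ is simulated in G started from v (the H₂-half of G
-- is observed at once), which gives the "furthermore" part.

open import Defs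
open import Data.Nat using (ℕ; zero; suc; _+_; _≤_; _<_; z≤n; s≤s)
import Data.Nat.Properties as ℕ
open import Data.Bool using (true; false)
open import Data.Fin as F using (Fin; _↑ˡ_; _↑ʳ_)
open import Data.Fin.Properties using (any?; all?; splitAt⁻¹-↑ˡ; splitAt⁻¹-↑ʳ)
  renaming (_≟_ to _≟F_)
open import Data.Fin.Subset using (⁅_⁆; ⊥; _∩_; _⊈_)
open import Data.Fin.Subset.Properties
  using (_∈?_; nonempty?; _⊆?_; ⊆-antisym; ⊆⊤; ⊆-refl; ∈⊤; x∈⁅x⁆; x∈⁅y⁆⇒x≡y;
         ∣⁅x⁆∣≡1; Empty-unique; x∈p∪q⁺; x∈p∪q⁻; x∈p∩q⁺; p∩q⊆p; p∩q⊆q;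
         p⊂q⇒∣p∣<∣q∣; p⊆q⇒∣p∣≤∣q∣; ∣p∣≤n; ∪-zeroˡ; ⊥⊆)
open import Data.Vec as V using ([]; _∷_; here; there)
open import Data.Vec.Properties using (lookup∘tabulate; lookup⇒[]=; []=⇒lookup; zipWith-++)
open import Data.List as L using (List)
import Data.List.Relation.Unary.Any as Any
open import Data.List.Membership.Propositional using (find; lose) renaming (_∈_ to _∈ₗ_)
open import Data.List.Membership.Propositional.Properties
  using (∈-map⁺; ∈-map⁻; ∈-concatMap⁺; ∈-concatMap⁻)
open import Data.Product using (Σ; ∃; _×_; _,_; proj₁; proj₂)
open import Data.Sum using (_⊎_; inj₁; inj₂; [_,_])
open import Data.Empty using (⊥-elim)
open import Relation.Nullary using (¬_; Dec; yes; no; does; contradiction)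
open import Relation.Nullary.Decidable
  using (map′; _×-dec_; _→-dec_; ¬?; dec-true; dec-false; decidable-stable)
open import Relation.Binary.PropositionalEquality using (_≡_; _≢_; refl; sym; trans; cong; cong₂; subst)
open import Relation.Binary.Construct.Closure.ReflexiveTransitive using (Star; ε; _◅_)
open import Function.Bundles using (_⇔_; mk⇔; Equivalence)
open Equivalence using (to; from)

any∈? : {A : Set} {P : A → Set} → (∀ x → Dec (P x)) →
        (xs : List A) → Dec (∃ λ x → x ∈ₗ xs × P x)
any∈? P? xs = map′ find (λ { (x , x∈xs , px) → lose x∈xs px }) (Any.any? P? xs)

select : ∀ {n} {P : Fin n → Set} → (∀ x → Dec (P x)) → Subset n
select P? = V.tabulate (λ x → does (P? x))

select⁺ : ∀ {n} {P : Fin n → Set} (P? : ∀ x → Dec (P x)) {x} → P x → x ∈ select P?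
select⁺ P? {x} px = lookup⇒[]= x _ (trans (lookup∘tabulate _ x) (dec-true (P? x) px))

select⁻ : ∀ {n} {P : Fin n → Set} (P? : ∀ x → Dec (P x)) {x} → x ∈ select P? → P x
select⁻ P? {x} x∈ = decidable-stable (P? x) λ ¬px →
  contradiction (trans (sym (dec-false (P? x) ¬px))
                       (trans (sym (lookup∘tabulate _ x)) ([]=⇒lookup x∈))) λ ()

⊈-witness : ∀ {n} {p q : Subset n} → p ⊈ q → ∃ λ x → x ∈ p × x ∉ q
⊈-witness {p = p} {q} p⊈q with any? (λ x → (x ∈? p) ×-dec ¬? (x ∈? q))
... | yes w = w
... | no none = ⊥-elim (p⊈q λ {x} x∈p →
        decidable-stable (x ∈? q) λ x∉q → none (x , x∈p , x∉q))

grows⇒∣<∣ : ∀ {n} {p q : Subset n} → p ⊆ q → q ⊈ p → ∣ p ∣ < ∣ q ∣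
grows⇒∣<∣ p⊆q q⊈p = p⊂q⇒∣p∣<∣q∣ (p⊆q , ⊈-witness q⊈p)

∪-monoˡ-⊆ : ∀ {n} {p q : Subset n} r → p ⊆ q → p ∪ r ⊆ q ∪ r
∪-monoˡ-⊆ r p⊆q x∈ =
  [ (λ x∈p → x∈p∪q⁺ (inj₁ (p⊆q x∈p))) , (λ x∈r → x∈p∪q⁺ (inj₂ x∈r)) ] (x∈p∪q⁻ _ r x∈)

nonempty⇒1≤∣∣ : ∀ {n} (p : Subset n) → Nonempty p → 1 ≤ ∣ p ∣
nonempty⇒1≤∣∣ p (x , x∈p) = subst (_≤ ∣ p ∣) (∣⁅x⁆∣≡1 x)
  (p⊆q⇒∣p∣≤∣q∣ λ y∈ → subst (_∈ p) (sym (x∈⁅y⁆⇒x≡y x y∈)) x∈p)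

∣∣≡1⇒singleton : ∀ {n} (p : Subset n) → ∣ p ∣ ≡ 1 → ∃ λ x → p ≡ ⁅ x ⁆
∣∣≡1⇒singleton (true ∷ p) ∣p∣≡1 =
  F.zero , cong (true ∷_) (Empty-unique λ ne →
    ℕ.<⇒≢ (nonempty⇒1≤∣∣ p ne) (sym (ℕ.suc-injective ∣p∣≡1)))
∣∣≡1⇒singleton (false ∷ p) ∣p∣≡1 with ∣∣≡1⇒singleton p ∣p∣≡1
... | x , refl = F.suc x , refl

non-singleton⇒2≤∣∣ : ∀ {n} (p : Subset n) → Nonempty p → ¬ (∃ λ x → p ≡ ⁅ x ⁆) → 2 ≤ ∣ p ∣
non-singleton⇒2≤∣∣ p ne ns with ∣ p ∣ in eq | nonempty⇒1≤∣∣ p ne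
... | suc zero    | _ = ⊥-elim (ns (∣∣≡1⇒singleton p eq))
... | suc (suc k) | _ = s≤s (s≤s z≤n)

split : ∀ m {n} (w : Fin (m + n)) → (∃ λ x → w ≡ x ↑ˡ n) ⊎ (∃ λ y → w ≡ m ↑ʳ y)
split m {n} w with F.splitAt m w in eq
... | inj₁ x = inj₁ (x , sym (splitAt⁻¹-↑ˡ {m} {n} eq))
... | inj₂ y = inj₂ (y , sym (splitAt⁻¹-↑ʳ {m} {n} eq))

++ˡ⁺ : ∀ {m n} {p : Subset m} {q : Subset n} {x} → x ∈ p → (x ↑ˡ n) ∈ (p V.++ q)
++ˡ⁺ here        = here
++ˡ⁺ (there x∈p) = there (++ˡ⁺ x∈p)

++ˡ⁻ : ∀ {m n} {p : Subset m} {q : Subset n} {x} → (x ↑ˡ n) ∈ (p V.++ q) → x ∈ p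
++ˡ⁻ {p = _ ∷ _} {x = F.zero}  here      = here
++ˡ⁻ {p = _ ∷ _} {x = F.suc x} (there m) = there (++ˡ⁻ m)

++ʳ⁺ : ∀ {m n} {p : Subset m} {q : Subset n} {y} → y ∈ q → (m ↑ʳ y) ∈ (p V.++ q)
++ʳ⁺ {p = []}    y∈q = y∈q
++ʳ⁺ {p = _ ∷ p} y∈q = there (++ʳ⁺ {p = p} y∈q)

++ʳ⁻ : ∀ {m n} (p : Subset m) {q : Subset n} {y} → (m ↑ʳ y) ∈ (p V.++ q) → y ∈ q
++ʳ⁻ []      y∈         = y∈
++ʳ⁻ (_ ∷ p) (there y∈) = ++ʳ⁻ p y∈

++-mono-⊆ : ∀ {m n} {p r : Subset m} {q s : Subset n} →
            p ⊆ r → q ⊆ s → (p V.++ q) ⊆ (r V.++ s)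
++-mono-⊆ {m} {p = p} p⊆r q⊆s {w} w∈ with split m w
... | inj₁ (x , refl) = ++ˡ⁺ (p⊆r (++ˡ⁻ w∈))
... | inj₂ (y , refl) = ++ʳ⁺ (q⊆s (++ʳ⁻ p w∈))

∪-++ : ∀ {m n} (p r : Subset m) (q s : Subset n) →
       (p V.++ q) ∪ (r V.++ s) ≡ (p ∪ r) V.++ (q ∪ s)
∪-++ p r q s = zipWith-++ _ p q r s

⊤++⊤ : ∀ m n → (⊤ {m} V.++ ⊤ {n}) ≡ ⊤
⊤++⊤ zero    n = refl
⊤++⊤ (suc m) n = cong (true ∷_) (⊤++⊤ m n)

∣++∣ : ∀ {m n} (p : Subset m) (q : Subset n) → ∣ p V.++ q ∣ ≡ ∣ p ∣ + ∣ q ∣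
∣++∣ []          q = refl
∣++∣ (true ∷ p)  q = cong suc (∣++∣ p q)
∣++∣ (false ∷ p) q = ∣++∣ p q

reaches⊤⇒nonempty : ∀ {n} {R : Subset n → Subset n → Set} → Fin n →
  (∀ {S S'} → R S S' → Nonempty S) → ∀ {S} → Star R S ⊤ → Nonempty S
reaches⊤⇒nonempty w _        ε       = w , ∈⊤
reaches⊤⇒nonempty w nonempty (r ◅ _) = nonempty r

Closed : ∀ {n} → (Subset n → Subset n → Set) → Subset n → Set
Closed R S = ∀ S' → R S S' → S' ⊆ S

module Reachability {n} (R : Subset n → Subset n → Set)
  (inflationary : ∀ {S S'} → R S S' → S ⊆ S')
  (monotone : ∀ {S S' T} → R S S' → S ⊆ T → ∃ λ T' → R T T' × S' ⊆ T')
  (grows? : ∀ S → (∃ λ S' → R S S' × S' ⊈ S) ⊎ Closed R S) where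

  ⊤-reached : ∀ {S} → ⊤ ⊆ S → Star R S ⊤
  ⊤-reached ⊤⊆S = subst (λ X → Star R X ⊤) (⊆-antisym ⊤⊆S ⊆⊤) ε

  reaches-upward : ∀ {S T} → Star R S ⊤ → S ⊆ T → Star R T ⊤
  reaches-upward ε       ⊤⊆T = ⊤-reached ⊤⊆T
  reaches-upward (r ◅ rs) S⊆T with monotone r S⊆T
  ... | _ , r′ , S′⊆T′ = r′ ◅ reaches-upward rs S′⊆T′

  closed-traps : ∀ {S X} → Closed R S → Star R X ⊤ → X ⊆ S → ⊤ ⊆ S
  closed-traps closed ε        X⊆S = X⊆S
  closed-traps closed (r ◅ rs) X⊆S with monotone r X⊆S
  ... | _ , r′ , X′⊆T′ = closed-traps closed rs (λ x∈ → closed _ r′ (X′⊆T′ x∈))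

  -- Each enlarging step uses up one unit of the room n - ∣ S ∣ ≤ fuel.
  reaches? : (fuel : ℕ) → ∀ S → n ≤ ∣ S ∣ + fuel → Dec (Star R S ⊤)
  reaches? fuel S room with grows? S
  ... | inj₂ closed =
    map′ ⊤-reached (λ st → closed-traps closed st ⊆-refl) (⊤ ⊆? S)
  reaches? zero S room | inj₁ (S′ , r , S′⊈S) =
    ⊥-elim (ℕ.≤⇒≯ (ℕ.≤-trans (∣p∣≤n S′) (subst (n ≤_) (ℕ.+-identityʳ _) room))
                   (grows⇒∣<∣ (inflationary r) S′⊈S))
  reaches? (suc k) S room | inj₁ (S′ , r , S′⊈S) =
    map′ (r ◅_) (λ st → reaches-upward st (inflationary r)) (reaches? k S′ room′)
    where
    room′ : n ≤ ∣ S′ ∣ + k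
    room′ = ℕ.≤-trans room (ℕ.≤-trans (ℕ.≤-reflexive (ℕ.+-suc ∣ S ∣ k))
                                      (ℕ.+-monoˡ-≤ k (grows⇒∣<∣ (inflationary r) S′⊈S)))

  reaches⊤? : ∀ S → Dec (Star R S ⊤)
  reaches⊤? S = reaches? n S (ℕ.m≤n+m n ∣ S ∣)

module OneHypergraph {n} (H : Hypergraph n) where

  inN? : ∀ a w → Dec (InN[ H ] a w)
  inN? a w = any∈? (λ e → (a ∈? e) ×-dec (w ∈? e)) (edges H)

  N⁻? : ∀ v w → Dec (InN[ H ] v w × w ≢ v)
  N⁻? v w = inN? v w ×-dec ¬? (w ≟F v)

  N⁻ : Fin n → Subset n
  N⁻ v = select (N⁻? v)

  Fires : Subset n → Fin n → Subset n → Set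
  Fires S v e = ∀ u → InN[ H ] v u → u ≢ v → u ∉ S → u ∈ e

  fires? : ∀ S v e → Dec (Fires S v e)
  fires? S v e = all? (λ u → inN? v u →-dec (¬? (u ≟F v) →-dec (¬? (u ∈? S) →-dec (u ∈? e))))

  pd-step : ∀ {S} v e → v ∈ S → e ∈ₗ edges H → v ∈ e → Fires S v e → PDStep H S (S ∪ N⁻ v)
  pd-step {S} v e v∈S e∈H v∈e fires = v , e , v∈S , e∈H , v∈e , fires , λ w →
    mk⇔ (λ w∈ → [ inj₁ , (λ w∈N → inj₂ (select⁻ (N⁻? v) w∈N)) ] (x∈p∪q⁻ S (N⁻ v) w∈))
        (λ { (inj₁ w∈S) → x∈p∪q⁺ (inj₁ w∈S) ; (inj₂ nb) → x∈p∪q⁺ (inj₂ (select⁺ (N⁻? v) nb)) })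

  pd-inflationary : ∀ {S S'} → PDStep H S S' → S ⊆ S'
  pd-inflationary (_ , _ , _ , _ , _ , _ , S′≡) x∈S = from (S′≡ _) (inj₁ x∈S)

  pd-result : ∀ {S S'} (st : PDStep H S S') → S' ⊆ S ∪ N⁻ (proj₁ st)
  pd-result (v , _ , _ , _ , _ , _ , S′≡) {w} w∈ =
    [ (λ w∈S → x∈p∪q⁺ (inj₁ w∈S)) , (λ nb → x∈p∪q⁺ (inj₂ (select⁺ (N⁻? v) nb))) ] (to (S′≡ w) w∈)

  pd-monotone : ∀ {S S' T} → PDStep H S S' → S ⊆ T → ∃ λ T' → PDStep H T T' × S' ⊆ T'
  pd-monotone {T = T} st@(v , e , v∈S , e∈H , v∈e , fires , _) S⊆T =
    T ∪ N⁻ v ,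
    pd-step v e (S⊆T v∈S) e∈H v∈e (λ u nb u≢v u∉T → fires u nb u≢v (λ u∈S → u∉T (S⊆T u∈S))) ,
    λ w∈ → ∪-monoˡ-⊆ (N⁻ v) S⊆T (pd-result st w∈)

  pd-grows? : ∀ S → (∃ λ S' → PDStep H S S' × S' ⊈ S) ⊎ Closed (PDStep H) S
  pd-grows? S with any? (λ v → any∈? (λ e → (v ∈? S) ×-dec ((v ∈? e) ×-dec
                      (fires? S v e ×-dec ¬? ((S ∪ N⁻ v) ⊆? S)))) (edges H))
  ... | yes (v , e , e∈H , v∈S , v∈e , fires , grows) = inj₁ (_ , pd-step v e v∈S e∈H v∈e fires , grows)
  ... | no none = inj₂ λ { _ st@(v , e , v∈S , e∈H , v∈e , fires , _) w∈ →
          decidable-stable ((S ∪ N⁻ v) ⊆? S)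
            (λ grows → none (v , e , e∈H , v∈S , v∈e , fires , grows)) (pd-result st w∈) }

  Infects : Subset n → Subset n → Subset n → Set
  Infects S A e = ∀ v → v ∉ S → (∃ λ f → f ∈ₗ edges H × A ⊆ f × v ∈ f) → v ∈ e

  infects? : ∀ S A e → Dec (Infects S A e)
  infects? S A e = all? (λ v → ¬? (v ∈? S) →-dec
    (any∈? (λ f → (A ⊆? f) ×-dec (v ∈? f)) (edges H) →-dec (v ∈? e)))

  ipd-inflationary : ∀ {S S'} → IPDStep H S S' → S ⊆ S'
  ipd-inflationary (_ , _ , _ , _ , _ , _ , _ , refl) x∈S = x∈p∪q⁺ (inj₁ x∈S)

  ipd-monotone : ∀ {S S' T} → IPDStep H S S' → S ⊆ T → ∃ λ T' → IPDStep H T T' × S' ⊆ T'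
  ipd-monotone {T = T} (A , e , ne , A⊆S , e∈H , A⊆e , infects , refl) S⊆T =
    T ∪ e , (A , e , ne , (λ a → S⊆T (A⊆S a)) , e∈H , A⊆e ,
             (λ v v∉T → infects v (λ v∈S → v∉T (S⊆T v∈S))) , refl) ,
    ∪-monoˡ-⊆ e S⊆T

  -- It suffices to try A = e ∩ S: it is the largest admissible A for e,
  -- and shrinking the infecting set only weakens the infection condition.
  ipd-grows? : ∀ S → (∃ λ S' → IPDStep H S S' × S' ⊈ S) ⊎ Closed (IPDStep H) S
  ipd-grows? S with any∈? (λ e → nonempty? (e ∩ S) ×-dec
                      (infects? S (e ∩ S) e ×-dec ¬? ((S ∪ e) ⊆? S))) (edges H)
  ... | yes (e , e∈H , ne , infects , grows) =
    inj₁ (S ∪ e , (e ∩ S , e , ne , p∩q⊆q e S , e∈H , p∩q⊆p e S , infects , refl) , grows)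
  ... | no none = inj₂ λ { _ (A , e , (x , x∈A) , A⊆S , e∈H , A⊆e , infects , refl) →
          decidable-stable ((S ∪ e) ⊆? S) λ grows → none
            (e , e∈H , (x , x∈p∩q⁺ (A⊆e x∈A , A⊆S x∈A)) ,
             (λ v v∉S (f , f∈H , e∩S⊆f , v∈f) →
                infects v v∉S (f , f∈H , (λ a → e∩S⊆f (x∈p∩q⁺ (A⊆e a , A⊆S a))) , v∈f)) ,
             grows) }

  module PDReach  = Reachability (PDStep H)  pd-inflationary  pd-monotone  pd-grows?
  module IPDReach = Reachability (IPDStep H) ipd-inflationary ipd-monotone ipd-grows?

  observes? : ∀ S₀ w → Dec (∃ λ d → d ∈ S₀ × InN[ H ] d w)
  observes? S₀ w = any? (λ d → (d ∈? S₀) ×-dec inN? d w)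

  N[_]⁺ : Subset n → Subset n
  N[ S₀ ]⁺ = select (observes? S₀)

  initial-N[] : ∀ S₀ → InitialSet H S₀ N[ S₀ ]⁺
  initial-N[] S₀ w = mk⇔ (select⁻ (observes? S₀)) (select⁺ (observes? S₀))

  initial-unique : ∀ {S₀ S} → InitialSet H S₀ S → S ≡ N[ S₀ ]⁺
  initial-unique {S₀} init = ⊆-antisym (λ x∈ → select⁺ (observes? S₀) (to (init _) x∈))
                                       (λ x∈ → from (init _) (select⁻ (observes? S₀) x∈))

  from-N[] : ∀ {R : Subset n → Subset n → Set} {S₀} →
             Dec (Star R N[ S₀ ]⁺ ⊤) → Dec (∃ λ S → InitialSet H S₀ S × Star R S ⊤)
  from-N[] {R} {S₀} = map′ (λ st → N[ S₀ ]⁺ , initial-N[] S₀ , st)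
                           (λ { (S , init , st) → subst (λ X → Star R X ⊤) (initial-unique init) st })

  pd? : ∀ S₀ → Dec (PowerDominating H S₀)
  pd? S₀ = from-N[] (PDReach.reaches⊤? N[ S₀ ]⁺)

  ipd? : ∀ S₀ → Dec (InfPowerDominating H S₀)
  ipd? S₀ = from-N[] (IPDReach.reaches⊤? N[ S₀ ]⁺)

  dom? : ∀ D → Dec (Dominating H D)
  dom? D = all? (λ w → any? (λ d → (d ∈? D) ×-dec inN? d w))

  dom⇒pd : ∀ {D} → Dominating H D → PowerDominating H D
  dom⇒pd dom = ⊤ , (λ w → mk⇔ (λ _ → dom w) (λ _ → ∈⊤)) , ε

  pd-step⇒ipd-step : ∀ {O O'} → PDStep H O O' → IPDStep H O O'
  pd-step⇒ipd-step {O} {O′} (v , e , v∈O , e∈H , v∈e , fires , O′≡) =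
    ⁅ v ⁆ , e , (v , x∈⁅x⁆ v) , at-v v∈O , e∈H , at-v v∈e ,
    (λ u u∉O (f , f∈H , v⊆f , u∈f) →
       fires u (f , f∈H , v⊆f (x∈⁅x⁆ v) , u∈f) (λ { refl → u∉O v∈O }) u∉O) ,
    ⊆-antisym O′⊆O∪e O∪e⊆O′
    where
    at-v : ∀ {X} → v ∈ X → ⁅ v ⁆ ⊆ X
    at-v v∈X u∈ = subst (_∈ _) (sym (x∈⁅y⁆⇒x≡y v u∈)) v∈X
    O′⊆O∪e : O′ ⊆ O ∪ e
    O′⊆O∪e {w} w∈ with to (O′≡ w) w∈ | w ∈? O
    ... | inj₁ w∈O        | _       = x∈p∪q⁺ (inj₁ w∈O)
    ... | inj₂ _          | yes w∈O = x∈p∪q⁺ (inj₁ w∈O)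
    ... | inj₂ (nb , w≢v) | no w∉O  = x∈p∪q⁺ (inj₂ (fires w nb w≢v w∉O))
    O∪e⊆O′ : O ∪ e ⊆ O′
    O∪e⊆O′ {w} w∈ with x∈p∪q⁻ O e w∈ | w ≟F v
    ... | inj₁ w∈O | _       = from (O′≡ w) (inj₁ w∈O)
    ... | inj₂ _   | yes refl = from (O′≡ w) (inj₁ v∈O)
    ... | inj₂ w∈e | no w≢v  = from (O′≡ w) (inj₂ ((e , e∈H , v∈e , w∈e) , w≢v))

  pd⇒ipd : ∀ {S₀} → PowerDominating H S₀ → InfPowerDominating H S₀
  pd⇒ipd (S , init , st) = S , init , star st
    where
    star : ∀ {O O'} → Star (PDStep H) O O' → Star (IPDStep H) O O'
    star ε        = ε
    star (r ◅ rs) = pd-step⇒ipd-step r ◅ star rs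

  module _ (w₀ : Fin n) where

    initial-nonempty : ∀ {S₀ S} → InitialSet H S₀ S → Nonempty S → Nonempty S₀
    initial-nonempty init (x , x∈S) with to (init x) x∈S
    ... | d , d∈S₀ , _ = d , d∈S₀

    dom-nonempty : ∀ S → Dominating H S → Nonempty S
    dom-nonempty S dom with dom w₀
    ... | d , d∈S , _ = d , d∈S

    pd-nonempty : ∀ S → PowerDominating H S → Nonempty S
    pd-nonempty S (O , init , st) = initial-nonempty init
      (reaches⊤⇒nonempty w₀ (λ { (v , _ , v∈O , _) → v , v∈O }) st)

    ipd-nonempty : ∀ S → InfPowerDominating H S → Nonempty S
    ipd-nonempty S (O , init , st) = initial-nonempty init
      (reaches⊤⇒nonempty w₀ (λ { (_ , _ , (x , x∈A) , A⊆S , _) → x , A⊆S x∈A }) st)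

isMin-antitone : ∀ {n} {P Q : Subset n → Set} {k j} →
  (∀ S → P S → Q S) → IsMin P k → IsMin Q j → j ≤ k
isMin-antitone P⇒Q ((S , pS , ∣S∣≡k) , _) (_ , Q-min) = subst (_ ≤_) ∣S∣≡k (Q-min S (P⇒Q S pS))

isMin-one⇒singleton : ∀ {n} {P : Subset n → Set} → IsMin P 1 → ∃ λ v → P ⁅ v ⁆
isMin-one⇒singleton ((S , pS , ∣S∣≡1) , _) with ∣∣≡1⇒singleton S ∣S∣≡1
... | v , refl = v , pS

module _ {n} {P : Subset n → Set} (nonempty : ∀ S → P S → Nonempty S) where

  isMin-one : ∀ v → P ⁅ v ⁆ → IsMin P 1
  isMin-one v pv = (⁅ v ⁆ , pv , ∣⁅x⁆∣≡1 v) , λ S pS → nonempty⇒1≤∣∣ S (nonempty S pS)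

  isMin-≤2 : (∀ S → Dec (P S)) → ∀ W → P W → ∣ W ∣ ≡ 2 → ∃ λ k → IsMin P k × k ≤ 2
  isMin-≤2 P? W pW ∣W∣≡2 with any? (λ v → P? ⁅ v ⁆)
  ... | yes (v , pv) = 1 , isMin-one v pv , s≤s z≤n
  ... | no none = 2 , ((W , pW , ∣W∣≡2) ,
          λ S pS → non-singleton⇒2≤∣∣ S (nonempty S pS) (λ { (v , refl) → none (v , pS) })) ,
        s≤s (s≤s z≤n)

some-edge : ∀ {n} (H : Hypergraph n) → WellFormed H → ∃ λ e → e ∈ₗ edges H
some-edge (hypergraph L.[])      (_ , no-edges , _) = ⊥-elim (no-edges refl)
some-edge (hypergraph (e L.∷ _)) _                 = e , Any.here refl

some-vertex : ∀ {n} (H : Hypergraph n) → WellFormed H → Fin n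
some-vertex H wf = proj₁ (proj₁ wf _ (proj₂ (some-edge H wf)))

path-first-edge : ∀ {n} {H : Hypergraph n} {u x} → Path H u x → u ≢ x → ∃ λ e → e ∈ₗ edges H × u ∈ e
path-first-edge record { len = zero ; start = s ; end = t } u≢x = ⊥-elim (u≢x (trans (sym s) t))
path-first-edge record { len = suc _ ; edgs = es ; edgs-in = es∈H ; left-in = left ; start = s } _ =
  es F.zero , es∈H F.zero , subst (_∈ es F.zero) s (left F.zero)

vertex-in-edge : ∀ {n} (H : Hypergraph n) → WellFormed H → Connected H →
                 ∀ u → ∃ λ e → e ∈ₗ edges H × u ∈ e
vertex-in-edge H wf conn u with some-edge H wf
... | e , e∈H with proj₁ wf e e∈H
... | x , x∈e with u ≟F x
... | yes refl = e , e∈H , x∈e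
... | no u≢x   = path-first-edge (conn u x) u≢x

module LinearSum {n₁ n₂} (H₁ : Hypergraph n₁) (H₂ : Hypergraph n₂)
  (wf₁ : WellFormed H₁) (wf₂ : WellFormed H₂) (c₁ : Connected H₁) (c₂ : Connected H₂) where

  G : Hypergraph (n₁ + n₂)
  G = H₁ ⋆ H₂

  ⋆-Edge : Subset (n₁ + n₂) → Set
  ⋆-Edge e = ∃ λ e₁ → ∃ λ e₂ → e₁ ∈ₗ edges H₁ × e₂ ∈ₗ edges H₂ × e ≡ e₁ V.++ e₂

  ⋆-edge⁺ : ∀ {e₁ e₂} → e₁ ∈ₗ edges H₁ → e₂ ∈ₗ edges H₂ → (e₁ V.++ e₂) ∈ₗ edges G
  ⋆-edge⁺ {e₁} e₁∈ e₂∈ = ∈-concatMap⁺ _ (lose e₁∈ (∈-map⁺ (e₁ V.++_) e₂∈))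

  ⋆-edge⁻ : ∀ {e} → e ∈ₗ edges G → ⋆-Edge e
  ⋆-edge⁻ e∈ with find (∈-concatMap⁻ (λ e₁ → L.map (e₁ V.++_) (edges H₂)) e∈)
  ... | e₁ , e₁∈ , e∈row with ∈-map⁻ (e₁ V.++_) e∈row
  ... | e₂ , e₂∈ , eq = e₁ , e₂ , e₁∈ , e₂∈ , eq

  -- Fixed edges of the factors, used to pad edges of the other factor.
  edge₁ : Subset n₁
  edge₁ = proj₁ (some-edge H₁ wf₁)

  edge₁∈ : edge₁ ∈ₗ edges H₁
  edge₁∈ = proj₂ (some-edge H₁ wf₁)

  edge₂ : Subset n₂
  edge₂ = proj₁ (some-edge H₂ wf₂)

  edge₂∈ : edge₂ ∈ₗ edges H₂
  edge₂∈ = proj₂ (some-edge H₂ wf₂)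

  across : ∀ a y → InN[ G ] (a ↑ˡ n₂) (n₁ ↑ʳ y) × InN[ G ] (n₁ ↑ʳ y) (a ↑ˡ n₂)
  across a y with vertex-in-edge H₁ wf₁ c₁ a | vertex-in-edge H₂ wf₂ c₂ y
  ... | e₁ , e₁∈ , a∈ | e₂ , e₂∈ , y∈ =
    (e₁ V.++ e₂ , ⋆-edge⁺ e₁∈ e₂∈ , ++ˡ⁺ a∈ , ++ʳ⁺ y∈) ,
    (e₁ V.++ e₂ , ⋆-edge⁺ e₁∈ e₂∈ , ++ʳ⁺ y∈ , ++ˡ⁺ a∈)

  adjacent₁⇔ : ∀ {a b} → InN[ G ] (a ↑ˡ n₂) (b ↑ˡ n₂) ⇔ InN[ H₁ ] a b
  adjacent₁⇔ = mk⇔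
    (λ { (e , e∈ , a∈ , b∈) → restrict₁ (⋆-edge⁻ e∈) a∈ b∈ })
    (λ { (e₁ , e₁∈ , a∈ , b∈) → e₁ V.++ edge₂ , ⋆-edge⁺ e₁∈ edge₂∈ , ++ˡ⁺ a∈ , ++ˡ⁺ b∈ })
    where
    restrict₁ : ∀ {e a b} → ⋆-Edge e → (a ↑ˡ n₂) ∈ e → (b ↑ˡ n₂) ∈ e → InN[ H₁ ] a b
    restrict₁ (e₁ , _ , e₁∈ , _ , refl) a∈ b∈ = e₁ , e₁∈ , ++ˡ⁻ a∈ , ++ˡ⁻ b∈

  adjacent₂⇔ : ∀ {a b} → InN[ G ] (n₁ ↑ʳ a) (n₁ ↑ʳ b) ⇔ InN[ H₂ ] a b
  adjacent₂⇔ = mk⇔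
    (λ { (e , e∈ , a∈ , b∈) → restrict₂ (⋆-edge⁻ e∈) a∈ b∈ })
    (λ { (e₂ , e₂∈ , a∈ , b∈) → edge₁ V.++ e₂ , ⋆-edge⁺ edge₁∈ e₂∈ , ++ʳ⁺ a∈ , ++ʳ⁺ b∈ })
    where
    restrict₂ : ∀ {e a b} → ⋆-Edge e → (n₁ ↑ʳ a) ∈ e → (n₁ ↑ʳ b) ∈ e → InN[ H₂ ] a b
    restrict₂ (e₁ , e₂ , _ , e₂∈ , refl) a∈ b∈ = e₂ , e₂∈ , ++ʳ⁻ e₁ a∈ , ++ʳ⁻ e₁ b∈

  x₁ : Fin n₁
  x₁ = some-vertex H₁ wf₁

  x₂ : Fin n₂
  x₂ = some-vertex H₂ wf₂

  pair : Subset (n₁ + n₂)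
  pair = ⁅ x₁ ⁆ V.++ ⁅ x₂ ⁆

  pair-dominating : Dominating G pair
  pair-dominating w with split n₁ w
  ... | inj₁ (b , refl) = n₁ ↑ʳ x₂ , ++ʳ⁺ {p = ⁅ x₁ ⁆} (x∈⁅x⁆ x₂) , proj₂ (across b x₂)
  ... | inj₂ (y , refl) = x₁ ↑ˡ n₂ , ++ˡ⁺ (x∈⁅x⁆ x₁) , proj₁ (across x₁ y)

  ∣pair∣≡2 : ∣ pair ∣ ≡ 2
  ∣pair∣≡2 = trans (∣++∣ ⁅ x₁ ⁆ ⁅ x₂ ⁆) (cong₂ _+_ (∣⁅x⁆∣≡1 x₁) (∣⁅x⁆∣≡1 x₂))

  initial₁ : ∀ {v S} → InitialSet H₁ ⁅ v ⁆ S → InitialSet G ⁅ v ↑ˡ n₂ ⁆ (S V.++ ⊤)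
  initial₁ {v} {S} init w = mk⇔ (λ w∈ → v ↑ˡ n₂ , x∈⁅x⁆ _ , observed w∈)
    (λ { (d , d∈ , nb) → reached (subst (λ z → InN[ G ] z w) (x∈⁅y⁆⇒x≡y _ d∈) nb) })
    where
    observed : w ∈ S V.++ ⊤ → InN[ G ] (v ↑ˡ n₂) w
    observed w∈ with split n₁ w
    ... | inj₂ (y , refl) = proj₁ (across v y)
    ... | inj₁ (b , refl) with to (init b) (++ˡ⁻ w∈)
    ... | d , d∈ , nb rewrite x∈⁅y⁆⇒x≡y v d∈ = from adjacent₁⇔ nb
    reached : InN[ G ] (v ↑ˡ n₂) w → w ∈ S V.++ ⊤
    reached nb with split n₁ w
    ... | inj₂ (y , refl) = ++ʳ⁺ {p = S} ∈⊤
    ... | inj₁ (b , refl) = ++ˡ⁺ (from (init b) (v , x∈⁅x⁆ v , to adjacent₁⇔ nb))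

  initial₂ : ∀ {v S} → InitialSet H₂ ⁅ v ⁆ S → InitialSet G ⁅ n₁ ↑ʳ v ⁆ (⊤ V.++ S)
  initial₂ {v} {S} init w = mk⇔ (λ w∈ → n₁ ↑ʳ v , x∈⁅x⁆ _ , observed w∈)
    (λ { (d , d∈ , nb) → reached (subst (λ z → InN[ G ] z w) (x∈⁅y⁆⇒x≡y _ d∈) nb) })
    where
    observed : w ∈ ⊤ V.++ S → InN[ G ] (n₁ ↑ʳ v) w
    observed w∈ with split n₁ w
    ... | inj₁ (b , refl) = proj₂ (across b v)
    ... | inj₂ (y , refl) with to (init y) (++ʳ⁻ ⊤ w∈)
    ... | d , d∈ , nb rewrite x∈⁅y⁆⇒x≡y v d∈ = from adjacent₂⇔ nb
    reached : InN[ G ] (n₁ ↑ʳ v) w → w ∈ ⊤ V.++ S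
    reached nb with split n₁ w
    ... | inj₁ (b , refl) = ++ˡ⁺ ∈⊤
    ... | inj₂ (y , refl) = ++ʳ⁺ (from (init y) (v , x∈⁅x⁆ v , to adjacent₂⇔ nb))

  ipd-step₁ : ∀ {S S'} → IPDStep H₁ S S' → IPDStep G (S V.++ ⊤) (S' V.++ ⊤)
  ipd-step₁ {S} (A , e₁ , (x , x∈A) , A⊆S , e₁∈ , A⊆e₁ , infects , refl) =
    A V.++ ⊥ , e₁ V.++ edge₂ , (x ↑ˡ n₂ , ++ˡ⁺ x∈A) , ++-mono-⊆ A⊆S ⊥⊆ ,
    ⋆-edge⁺ e₁∈ edge₂∈ , ++-mono-⊆ A⊆e₁ ⊥⊆ , infects′ ,
    trans (cong ((S ∪ e₁) V.++_) (sym (∪-zeroˡ edge₂))) (sym (∪-++ S e₁ ⊤ edge₂))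
    where
    infects′ : ∀ v → v ∉ S V.++ ⊤ → (∃ λ f → f ∈ₗ edges G × (A V.++ ⊥) ⊆ f × v ∈ f) →
               v ∈ e₁ V.++ edge₂
    infects′ v v∉ (f , f∈ , A⊆f , v∈f) with split n₁ v | ⋆-edge⁻ f∈
    ... | inj₂ (y , refl) | _ = ⊥-elim (v∉ (++ʳ⁺ {p = S} ∈⊤))
    ... | inj₁ (b , refl) | f₁ , _ , f₁∈ , _ , refl =
      ++ˡ⁺ (infects b (λ b∈S → v∉ (++ˡ⁺ b∈S))
                      (f₁ , f₁∈ , (λ a → ++ˡ⁻ (A⊆f (++ˡ⁺ a))) , ++ˡ⁻ v∈f))

  ipd-step₂ : ∀ {S S'} → IPDStep H₂ S S' → IPDStep G (⊤ V.++ S) (⊤ V.++ S')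
  ipd-step₂ {S} (A , e₂ , (x , x∈A) , A⊆S , e₂∈ , A⊆e₂ , infects , refl) =
    ⊥ V.++ A , edge₁ V.++ e₂ , (n₁ ↑ʳ x , ++ʳ⁺ x∈A) , ++-mono-⊆ ⊥⊆ A⊆S ,
    ⋆-edge⁺ edge₁∈ e₂∈ , ++-mono-⊆ ⊥⊆ A⊆e₂ , infects′ ,
    trans (cong (V._++ (S ∪ e₂)) (sym (∪-zeroˡ edge₁))) (sym (∪-++ ⊤ edge₁ S e₂))
    where
    infects′ : ∀ v → v ∉ ⊤ V.++ S → (∃ λ f → f ∈ₗ edges G × (⊥ V.++ A) ⊆ f × v ∈ f) →
               v ∈ edge₁ V.++ e₂
    infects′ v v∉ (f , f∈ , A⊆f , v∈f) with split n₁ v | ⋆-edge⁻ f∈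
    ... | inj₁ (b , refl) | _ = ⊥-elim (v∉ (++ˡ⁺ ∈⊤))
    ... | inj₂ (y , refl) | f₁ , f₂ , _ , f₂∈ , refl =
      ++ʳ⁺ (infects y (λ y∈S → v∉ (++ʳ⁺ y∈S))
                      (f₂ , f₂∈ , (λ a → ++ʳ⁻ f₁ (A⊆f (++ʳ⁺ a))) , ++ʳ⁻ f₁ v∈f))

  ipd-lift₁ : ∀ v → InfPowerDominating H₁ ⁅ v ⁆ → InfPowerDominating G ⁅ v ↑ˡ n₂ ⁆
  ipd-lift₁ v (S , init , st) = S V.++ ⊤ , initial₁ init , subst (Star (IPDStep G) _) (⊤++⊤ n₁ n₂) (lift st)
    where
    lift : ∀ {S T} → Star (IPDStep H₁) S T → Star (IPDStep G) (S V.++ ⊤) (T V.++ ⊤)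
    lift ε        = ε
    lift (r ◅ rs) = ipd-step₁ r ◅ lift rs

  ipd-lift₂ : ∀ v → InfPowerDominating H₂ ⁅ v ⁆ → InfPowerDominating G ⁅ n₁ ↑ʳ v ⁆
  ipd-lift₂ v (S , init , st) = ⊤ V.++ S , initial₂ init , subst (Star (IPDStep G) _) (⊤++⊤ n₁ n₂) (lift st)
    where
    lift : ∀ {S T} → Star (IPDStep H₂) S T → Star (IPDStep G) (⊤ V.++ S) (⊤ V.++ T)
    lift ε        = ε
    lift (r ◅ rs) = ipd-step₂ r ◅ lift rs

theorem6p3 : ∀ {n₁ n₂} (H₁ : Hypergraph n₁) (H₂ : Hypergraph n₂) →
    WellFormed H₁ → WellFormed H₂ → Connected H₁ → Connected H₂ →
    (Σ ℕ λ a → Σ ℕ λ b → Σ ℕ λ c →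
       IsMin (InfPowerDominating (H₁ ⋆ H₂)) a ×
       IsMin (PowerDominating (H₁ ⋆ H₂)) b ×
       IsMin (Dominating (H₁ ⋆ H₂)) c ×
       a ≤ b × b ≤ c × c ≤ 2)
    × (IsMin (InfPowerDominating H₁) 1 ⊎ IsMin (InfPowerDominating H₂) 1 →
       IsMin (InfPowerDominating (H₁ ⋆ H₂)) 1)
theorem6p3 {n₁} {n₂} H₁ H₂ wf₁ wf₂ c₁ c₂ =
  let a , minI , _   = isMin-≤2 (ipd-nonempty w₀) ipd? pair (pd⇒ipd (dom⇒pd pair-dominating)) ∣pair∣≡2
      b , minP , _   = isMin-≤2 (pd-nonempty w₀) pd? pair (dom⇒pd pair-dominating) ∣pair∣≡2
      c , minD , c≤2 = isMin-≤2 (dom-nonempty w₀) dom? pair pair-dominating ∣pair∣≡2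
  in (a , b , c , minI , minP , minD ,
      isMin-antitone (λ _ → pd⇒ipd) minP minI , isMin-antitone (λ _ → dom⇒pd) minD minP , c≤2) ,
     [ lift-singleton ipd-lift₁ , lift-singleton ipd-lift₂ ]
  where
  open LinearSum H₁ H₂ wf₁ wf₂ c₁ c₂
  open OneHypergraph G
  w₀ : Fin (n₁ + n₂)
  w₀ = x₁ ↑ˡ n₂
  lift-singleton : ∀ {m} {P : Subset m → Set} {ι : Fin m → Fin (n₁ + n₂)} →
    (∀ v → P ⁅ v ⁆ → InfPowerDominating G ⁅ ι v ⁆) → IsMin P 1 → IsMin (InfPowerDominating G) 1
  lift-singleton lift min₁ =
    let v , pv = isMin-one⇒singleton min₁ in isMin-one (ipd-nonempty w₀) _ (lift v pv)
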